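{- Let $k\ge 9$ be an integer and let $r,s$ be distinct elements of $\mathbb{Z}_{2k}$ such that $T_1(k,r,s)$ is a connected simple graph. If $4r-4s\equiv 0 \pmod{2k}$, then $T_1(k,r,s)$ is not vertex-transitive.
   Context: $T_1(k,r,s)$ is the graph with vertex set $\{u_i,v_i,w_i: i\in\mathbb{Z}_{2k}\}$ and edges $u_iu_{i+k}$, $u_iv_i$, $u_iw_i$, $v_iw_{i+r}$, $v_iw_{i+s}$ ($i\in\mathbb{Z}_{2k}$). -}

module Defs where

open import Data.Nat using (ℕ; zero; suc; _+_; _*_)
open import Data.Nat.DivMod using (_%_; m%n<n)
open import Data.Fin using (Fin; toℕ; fromℕ<)
open import Data.Product using (_×_; _,_; Σ-syntax)
open import Data.Integer as ℤ using (ℤ; +_)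
open import Data.Integer.Divisibility as ℤD using ()
open import Function.Bundles using (_↔_; Inverse)
open import Relation.Binary.PropositionalEquality using (_≡_)
open import Relation.Binary.Construct.Closure.ReflexiveTransitive using (Star)

-- i + m in ℤ_n (for n = 0 the index type is empty)
_⊕_ : ∀ {n} → Fin n → ℕ → Fin n
_⊕_ {suc n} i m = fromℕ< (m%n<n (toℕ i + m) (suc n))

data Kind : Set where
  u v w : Kind

Vtx : ℕ → Set
Vtx k = Kind × Fin (2 * k)

-- adjacency (symmetric) of T₁(k,r,s); edges
-- u_i u_{i+k}, u_i v_i, u_i w_i, v_i w_{i+r}, v_i w_{i+s}
data Adj (k : ℕ) (r s : Fin (2 * k)) : Vtx k → Vtx k → Set where
  uu  : ∀ i → Adj k r s (u , i) (u , i ⊕ k)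
  uu' : ∀ i → Adj k r s (u , i ⊕ k) (u , i)
  uv  : ∀ i → Adj k r s (u , i) (v , i)
  vu  : ∀ i → Adj k r s (v , i) (u , i)
  uw  : ∀ i → Adj k r s (u , i) (w , i)
  wu  : ∀ i → Adj k r s (w , i) (u , i)
  vwr : ∀ i → Adj k r s (v , i) (w , i ⊕ toℕ r)
  wvr : ∀ i → Adj k r s (w , i ⊕ toℕ r) (v , i)
  vws : ∀ i → Adj k r s (v , i) (w , i ⊕ toℕ s)
  wvs : ∀ i → Adj k r s (w , i ⊕ toℕ s) (v , i)

Connected : (k : ℕ) (r s : Fin (2 * k)) → Set
Connected k r s = ∀ x y → Star (Adj k r s) x y

record Automorphism (k : ℕ) (r s : Fin (2 * k)) : Set where
  field
    perm : Vtx k ↔ Vtx k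
  open Inverse perm public
  field
    preserves : ∀ x y → Adj k r s x y → Adj k r s (to x) (to y)
    reflects  : ∀ x y → Adj k r s (to x) (to y) → Adj k r s x y

VertexTransitive : (k : ℕ) (r s : Fin (2 * k)) → Set
VertexTransitive k r s =
  ∀ x y → Σ[ σ ∈ Automorphism k r s ] Automorphism.to σ x ≡ y

FourRSCond : (k : ℕ) (r s : Fin (2 * k)) → Set
FourRSCond k r s = (+ (2 * k)) ℤD.∣ ((+ (4 * toℕ r)) ℤ.- (+ (4 * toℕ s)))

module Submission where

-- Call a vertex x pinned at length L if some neighbour of x lies on every closed walk of
-- length L at x; automorphisms preserve this.  Writing s ≡ r + d, the hypothesis forces
-- d = k, or k = 2g with d ∈ {g, 3g}; in each case k = κ g, s ≡ r + σ g and 2k = N g.  Then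
-- every index reached from a base index i₀ along a walk is i₀ + β r + δ g, walks of T₁
-- project to walks in the nine-arc quotient graph on the kinds u, v, w, and arc paths lift
-- back.  Connectivity gives gcd(g, r) = 1, so for |β| < 5 ≤ g such an index is i₀ exactly when
-- β = 0 and N ∣ δ.  Hence "u_{i₀} is pinned by u_{i₀+k}" and "v_{i₀} is not pinned" (closed
-- walks of length 5 for d = k, of length 7 otherwise) reduce to finite checks on arc paths,
-- decided by evaluation; vertex-transitivity would map u_{i₀} to v_{i₀}.

open import Defs
open import Data.Nat as ℕ using (ℕ; zero; suc)
import Data.Nat.Properties as ℕP
import Data.Nat.Divisibility as ℕD
open import Data.Nat.Coprimality using (Coprime; coprime-divisor)
open import Data.Nat.DivMod using (m%n<n; m≡m%n+[m/n]*n) renaming (_%_ to _%ℕ_; _/_ to _/ℕ_)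
open import Data.Fin using (Fin; toℕ)
import Data.Fin.Properties as FinP
open import Data.Integer as ℤ using (ℤ; +_; _⊖_; 0ℤ; 1ℤ; -1ℤ; _+_; _-_; _*_; -_; ∣_∣)
import Data.Integer.Properties as ℤP
open import Data.Integer.Divisibility.Signed
open import Data.Integer.Tactic.RingSolver using (solve-∀)
import Data.Nat.Tactic.RingSolver as ℕSolver
open import Data.Product using (Σ-syntax; _×_; _,_; proj₁; proj₂)
open import Data.Empty using (⊥-elim)
open import Data.Unit using (tt)
open import Function.Bundles using (_↔_; Inverse)
open import Data.Bool using (Bool; true; T; _∧_)
open import Data.List.Relation.Unary.Any using (Any; here; there; any?)
open import Data.List.Relation.Unary.All using (All; _∷_; all?)
open import Data.List.Relation.Binary.Pointwise using (Pointwise; []; _∷_)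
open import Relation.Nullary using (Dec; yes; no; ¬_)
open import Relation.Nullary.Decidable using (_×-dec_; _→-dec_; ¬?; isYes; toWitness)
open import Data.List using (List; []; _∷_; map)
open import Data.List.Membership.Propositional using (_∈_)
open import Data.List.Membership.Propositional.Properties using (∈-map⁻)
open import Relation.Binary.Bundles using (Setoid)
open import Relation.Binary.Structures using (IsEquivalence)
open import Relation.Binary.PropositionalEquality
open import Relation.Binary.Construct.Closure.ReflexiveTransitive using (Star; ε; _◅_)
import Relation.Binary.Reasoning.Setoid as SetoidReasoning

toℤ : ∀ {n} → Fin n → ℤ
toℤ i = + toℕ i

divisible-below⇒0 : ∀ {n a} → n ℕD.∣ a → a ℕ.< n → a ≡ 0
divisible-below⇒0 {a = zero}  _   _ = refl
divisible-below⇒0 {a = suc _} n∣a a<n = ⊥-elim (ℕP.<⇒≱ a<n (ℕD.∣⇒≤ n∣a))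

module _ {A B : Set} {R : A → B → Set} {P : B → Set} {Q : A → Set} where

  any-along : ∀ {xs ys} → Pointwise R xs ys → (∀ {x y} → R x y → P y → Q x) → Any P ys → Any Q xs
  any-along (xRy ∷ _)  transfer (here py)   = here (transfer xRy py)
  any-along (_ ∷ xsRys) transfer (there pys) = there (any-along xsRys transfer pys)

  none-along : ∀ {xs ys} → Pointwise R xs ys → (∀ {x y} → R x y → P y → ¬ Q x) → All P ys → ¬ Any Q xs
  none-along (xRy ∷ _)  exclude (py ∷ _)   (here qx)   = exclude xRy py qx
  none-along (_ ∷ xsRys) exclude (_ ∷ pys) (there qxs) = none-along xsRys exclude pys qxs

module Modular (n : ℕ) where

  infix 4 _≈_
  -- a record rather than a synonym, so that both sides stay inferable
  record _≈_ (a b : ℤ) : Set where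
    constructor mod
    field divides-difference : + n ∣ a - b
  open _≈_ public

  ∣⇒≈0 : ∀ {a} → + n ∣ a → a ≈ 0ℤ
  ∣⇒≈0 {a} n∣a = mod (subst (+ n ∣_) (sym (ℤP.+-identityʳ a)) n∣a)

  ≈0⇒∣ : ∀ {a} → a ≈ 0ℤ → + n ∣ a
  ≈0⇒∣ {a} (mod n∣a) = subst (+ n ∣_) (ℤP.+-identityʳ a) n∣a

  ≈-reflexive : ∀ {a b} → a ≡ b → a ≈ b
  ≈-reflexive {a} refl = mod (subst (+ n ∣_) (sym (ℤP.+-inverseʳ a)) (divides 0ℤ refl))

  ≈-isEquivalence : IsEquivalence _≈_
  ≈-isEquivalence = record
    { refl  = ≈-reflexive refl
    ; sym   = λ {a} {b} (mod a≈b) → mod (subst (+ n ∣_) (negate-difference a b) (∣m⇒∣-m a≈b))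
    ; trans = λ {a} {b} {c} (mod a≈b) (mod b≈c) →
        mod (subst (+ n ∣_) (sym (split-difference a b c)) (∣m∣n⇒∣m+n a≈b b≈c))
    }
    where
    negate-difference : ∀ a b → - (a - b) ≡ b - a
    negate-difference = solve-∀
    split-difference : ∀ a b c → a - c ≡ (a - b) + (b - c)
    split-difference = solve-∀

  ≈-setoid : Setoid _ _
  ≈-setoid = record { isEquivalence = ≈-isEquivalence }

  open IsEquivalence ≈-isEquivalence public
    using () renaming (refl to ≈-refl; sym to ≈-sym; trans to ≈-trans)
  open SetoidReasoning ≈-setoid public

  neg-cong : ∀ {a b} → a ≈ b → - a ≈ - b
  neg-cong {a} {b} (mod a≈b) = mod (subst (+ n ∣_) (sym (negate a b)) (∣m⇒∣-m a≈b))
    where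
    negate : ∀ a b → - a - - b ≡ - (a - b)
    negate = solve-∀

  +-cong : ∀ {a b c d} → a ≈ b → c ≈ d → a + c ≈ b + d
  +-cong {a} {b} {c} {d} (mod a≈b) (mod c≈d) =
    mod (subst (+ n ∣_) (sym (regroup a b c d)) (∣m∣n⇒∣m+n a≈b c≈d))
    where
    regroup : ∀ a b c d → (a + c) - (b + d) ≡ (a - b) + (c - d)
    regroup = solve-∀

  +-cancelˡ : ∀ a {b c} → a + b ≈ a + c → b ≈ c
  +-cancelˡ a {b} {c} (mod n∣d) = mod (subst (+ n ∣_) (cancel a b c) n∣d)
    where
    cancel : ∀ a b c → (a + b) - (a + c) ≡ b - c
    cancel = solve-∀

  *-congˡ : ∀ c {a b} → a ≈ b → c * a ≈ c * b
  *-congˡ c {a} {b} (mod a≈b) = mod (subst (+ n ∣_) (sym (factor c a b)) (∣n⇒∣m*n c a≈b))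
    where
    factor : ∀ c a b → c * a - c * b ≡ c * (a - b)
    factor = solve-∀

  +-multiple : ∀ a q → a + q * + n ≈ a
  +-multiple a q = mod (subst (+ n ∣_) (sym (cancel a q (+ n))) (∣n⇒∣m*n q ∣-refl))
    where
    cancel : ∀ a q m → a + q * m - a ≡ q * m
    cancel = solve-∀

∣⊖∣≡distance : ∀ m n → ∣ m ⊖ n ∣ ≡ ℕ.∣ m - n ∣
∣⊖∣≡distance zero    zero    = refl
∣⊖∣≡distance zero    (suc n) = refl
∣⊖∣≡distance (suc m) zero    = refl
∣⊖∣≡distance (suc m) (suc n) = trans (cong ∣_∣ (ℤP.+-cancelˡ-⊖ 1 m n)) (∣⊖∣≡distance m n)

index-distance< : ∀ {n} (i j : Fin n) → ∣ toℤ i - toℤ j ∣ ℕ.< n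
index-distance< {n} i j = begin-strict
  ∣ toℤ i - toℤ j ∣             ≡⟨ cong ∣_∣ (ℤP.m-n≡m⊖n (toℕ i) (toℕ j)) ⟩
  ∣ toℕ i ⊖ toℕ j ∣             ≡⟨ ∣⊖∣≡distance (toℕ i) (toℕ j) ⟩
  ℕ.∣ toℕ i - toℕ j ∣           ≤⟨ ℕP.∣m-n∣≤m⊔n (toℕ i) (toℕ j) ⟩
  toℕ i ℕ.⊔ toℕ j               <⟨ ℕP.⊔-lub (FinP.toℕ<n i) (FinP.toℕ<n j) ⟩
  n                             ∎
  where open ℕP.≤-Reasoning

≈⇒≡ : ∀ {n} (i j : Fin n) → Modular._≈_ n (toℤ i) (toℤ j) → i ≡ j
≈⇒≡ i j i≈j = FinP.toℕ-injective (ℤP.+-injective (ℤP.i-j≡0⇒i≡j (toℤ i) (toℤ j)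
  (ℤP.∣i∣≡0⇒i≡0 (divisible-below⇒0 (∣⇒∣ᵤ (Modular.divides-difference i≈j)) (index-distance< i j)))))

⊕-correct : ∀ {n} (i : Fin n) m → Modular._≈_ n (toℤ (i ⊕ m)) (toℤ i + + m)
⊕-correct {suc n} i m = begin
  toℤ (i ⊕ m)                         ≡⟨ cong +_ (FinP.toℕ-fromℕ< (m%n<n x (suc n))) ⟩
  + (x %ℕ suc n)                      ≈⟨ ≈-sym (+-multiple _ (+ (x /ℕ suc n))) ⟩
  + (x %ℕ suc n) + + (x /ℕ suc n) * + suc n  ≡⟨ division-identity ⟩
  + x                                 ≡⟨ ℤP.pos-+ (toℕ i) m ⟩
  toℤ i + + m                         ∎
  where
  open Modular (suc n)
  x = toℕ i ℕ.+ m
  division-identity : + (x %ℕ suc n) + + (x /ℕ suc n) * + suc n ≡ + x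
  division-identity = sym (trans (cong +_ (m≡m%n+[m/n]*n x (suc n)))
    (trans (ℤP.pos-+ (x %ℕ suc n) _) (cong (λ z → + (x %ℕ suc n) + z) (ℤP.pos-* (x /ℕ suc n) (suc n)))))

⊕-cancel : ∀ {n} (i : Fin n) m → m ℕ.≤ n → (i ⊕ (n ℕ.∸ m)) ⊕ m ≡ i
⊕-cancel {n} i m m≤n = ≈⇒≡ _ i (begin
  toℤ ((i ⊕ (n ℕ.∸ m)) ⊕ m)          ≈⟨ ⊕-correct (i ⊕ (n ℕ.∸ m)) m ⟩
  toℤ (i ⊕ (n ℕ.∸ m)) + + m          ≈⟨ +-cong (⊕-correct i (n ℕ.∸ m)) (≈-refl {+ m}) ⟩
  toℤ i + + (n ℕ.∸ m) + + m          ≡⟨ ℤP.+-assoc (toℤ i) (+ (n ℕ.∸ m)) (+ m) ⟩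
  toℤ i + (+ (n ℕ.∸ m) + + m)        ≡⟨ cong (_+_ (toℤ i)) n-m+m≡n ⟩
  toℤ i + + n                        ≡⟨ cong (_+_ (toℤ i)) (sym (ℤP.*-identityˡ (+ n))) ⟩
  toℤ i + 1ℤ * + n                   ≈⟨ +-multiple (toℤ i) 1ℤ ⟩
  toℤ i                              ∎)
  where
  open Modular n
  n-m+m≡n : + (n ℕ.∸ m) + + m ≡ + n
  n-m+m≡n = trans (sym (ℤP.pos-+ (n ℕ.∸ m) m)) (cong +_ (ℕP.m∸n+n≡m m≤n))

difference-correct : ∀ {n} (i j : Fin n) → Modular._≈_ n (toℤ j) (toℤ i + toℤ (j ⊕ (n ℕ.∸ toℕ i)))
difference-correct {n} i j = begin
  toℤ j                                 ≡⟨ cong toℤ (sym (⊕-cancel j (toℕ i) (ℕP.<⇒≤ (FinP.toℕ<n i)))) ⟩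
  toℤ ((j ⊕ (n ℕ.∸ toℕ i)) ⊕ toℕ i)     ≈⟨ ⊕-correct (j ⊕ (n ℕ.∸ toℕ i)) (toℕ i) ⟩
  toℤ (j ⊕ (n ℕ.∸ toℕ i)) + toℤ i       ≡⟨ ℤP.+-comm (toℤ (j ⊕ (n ℕ.∸ toℕ i))) (toℤ i) ⟩
  toℤ i + toℤ (j ⊕ (n ℕ.∸ toℕ i))       ∎
  where open Modular n

difference-nonzero : ∀ {n} (i j : Fin n) → i ≢ j → 0 ℕ.< toℕ (j ⊕ (n ℕ.∸ toℕ i))
difference-nonzero {n} i j i≢j = ℕP.n≢0⇒n>0 λ d≡0 → i≢j (sym (≈⇒≡ j i
  (≈-trans (difference-correct i j) (≈-reflexive (trans (cong (λ d → toℤ i + + d) d≡0) (ℤP.+-identityʳ (toℤ i)))))))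
  where open Modular n

module Walks {V : Set} (E : V → V → Set) where

  infixr 5 _∷_
  data Walk : ℕ → V → V → Set where
    []  : ∀ {x} → Walk 0 x x
    _∷_ : ∀ {x y z L} → E x y → Walk L y z → Walk (suc L) x z

  vertices : ∀ {L x y} → Walk L x y → List V
  vertices {x = x} []      = x ∷ []
  vertices {x = x} (_ ∷ W) = x ∷ vertices W

  retarget : ∀ {L x x' y y'} → x ≡ x' → y ≡ y' → Walk L x y → Walk L x' y'
  retarget refl refl W = W

  vertices-retarget : ∀ {L x x' y y'} (p : x ≡ x') (q : y ≡ y') (W : Walk L x y) →
                      vertices (retarget p q W) ≡ vertices W
  vertices-retarget refl refl W = refl

  mapWalk : (f : V → V) → (∀ {x y} → E x y → E (f x) (f y)) →
            ∀ {L x y} → Walk L x y → Walk L (f x) (f y)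
  mapWalk f hom []      = []
  mapWalk f hom (e ∷ W) = hom e ∷ mapWalk f hom W

  vertices-mapWalk : ∀ f (hom : ∀ {x y} → E x y → E (f x) (f y)) {L x y} (W : Walk L x y) →
                     vertices (mapWalk f hom W) ≡ map f (vertices W)
  vertices-mapWalk f hom []      = refl
  vertices-mapWalk f hom (e ∷ W) = cong (f _ ∷_) (vertices-mapWalk f hom W)

  Pinned : ℕ → V → Set
  Pinned L x = Σ[ y ∈ V ] E x y × (∀ (W : Walk L x x) → y ∈ vertices W)

  -- being pinned is preserved by every automorphism τ: a closed walk at τ x is pulled back
  -- along τ⁻¹ to a closed walk at x, whose pinning neighbour y gives τ y on the original walk
  pinned-invariant : (τ : V ↔ V) → let open Inverse τ in
                     (∀ {x y} → E x y → E (to x) (to y)) → (∀ {x y} → E x y → E (from x) (from y)) →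
                     ∀ {L x} → Pinned L x → Pinned L (to x)
  pinned-invariant τ to-hom from-hom {L} {x} (y , x~y , pins) = to y , to-hom x~y , pins-image
    where
    open Inverse τ
    pullback : Walk L (to x) (to x) → Walk L x x
    pullback W = retarget (strictlyInverseʳ x) (strictlyInverseʳ x) (mapWalk from from-hom W)

    pulled-vertices : ∀ W → vertices (pullback W) ≡ map from (vertices W)
    pulled-vertices W = trans (vertices-retarget _ _ (mapWalk from from-hom W)) (vertices-mapWalk from from-hom W)

    pins-image : (W : Walk L (to x) (to x)) → to y ∈ vertices W
    pins-image W with ∈-map⁻ from (subst (y ∈_) (pulled-vertices W) (pins (pullback W)))
    ... | z , z∈W , y≡from-z = subst (_∈ vertices W) (sym (trans (cong to y≡from-z) (strictlyInverseˡ z))) z∈W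

-- The rotation i ↦ i + 1 acts on T₁(k,r,s) with quotient the graph on the kinds u, v, w
-- below; each edge of T₁ lies over one of its nine arcs (one arc per edge direction).
data Arc : Kind → Kind → Set where
  u-u        : Arc u u   -- u_i → u_{i+k}
  u-v        : Arc u v   -- u_i → v_i
  u-w        : Arc u w   -- u_i → w_i
  v-u        : Arc v u   -- v_i → u_i
  w-u        : Arc w u   -- w_i → u_i
  v-wr v-ws  : Arc v w   -- v_i → w_{i+r},  v_i → w_{i+s}
  wr-v ws-v  : Arc w v   -- w_{i+r} → v_i,  w_{i+s} → v_i

-- When k = κ g and s = r + σ g (mod 2k), an arc moves the index by
-- (r-coeff a) r + (g-coeff a) g.
r-coeff : ∀ {K K'} → Arc K K' → ℤ
r-coeff v-wr = 1ℤ
r-coeff v-ws = 1ℤ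
r-coeff wr-v = -1ℤ
r-coeff ws-v = -1ℤ
r-coeff _    = 0ℤ

g-coeff : (κ σ : ℤ) → ∀ {K K'} → Arc K K' → ℤ
g-coeff κ σ u-u  = κ
g-coeff κ σ v-ws = σ
g-coeff κ σ ws-v = - σ
g-coeff κ σ _    = 0ℤ

_≟ₖ_ : (K K' : Kind) → Dec (K ≡ K')
u ≟ₖ u = yes refl
v ≟ₖ v = yes refl
w ≟ₖ w = yes refl
u ≟ₖ v = no λ ()
u ≟ₖ w = no λ ()
v ≟ₖ u = no λ ()
v ≟ₖ w = no λ ()
w ≟ₖ u = no λ ()
w ≟ₖ v = no λ ()

infixr 5 _∷_
data ArcPath : ℕ → Kind → Kind → Set where
  []  : ∀ {K} → ArcPath 0 K K
  _∷_ : ∀ {K K' K'' L} → Arc K K' → ArcPath L K' K'' → ArcPath (suc L) K K''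

every-arc : ∀ K → (∀ {K'} → Arc K K' → Bool) → Bool
every-arc u f = f u-u ∧ f u-v ∧ f u-w
every-arc v f = f v-u ∧ f v-wr ∧ f v-ws
every-arc w f = f w-u ∧ f wr-v ∧ f ws-v

T-∧₃ : ∀ {a b c} → T (a ∧ b ∧ c) → T a × T b × T c
T-∧₃ {true} {true} {true} _ = _ , _ , _

every-arc-sound : ∀ {K K'} (f : ∀ {K'} → Arc K K' → Bool) → T (every-arc K f) → (a : Arc K K') → T (f a)
every-arc-sound f all-f u-u  = proj₁ (T-∧₃ {f u-u} {f u-v} all-f)
every-arc-sound f all-f u-v  = proj₁ (proj₂ (T-∧₃ {f u-u} {f u-v} all-f))
every-arc-sound f all-f u-w  = proj₂ (proj₂ (T-∧₃ {f u-u} {f u-v} all-f))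
every-arc-sound f all-f v-u  = proj₁ (T-∧₃ {f v-u} {f v-wr} all-f)
every-arc-sound f all-f v-wr = proj₁ (proj₂ (T-∧₃ {f v-u} {f v-wr} all-f))
every-arc-sound f all-f v-ws = proj₂ (proj₂ (T-∧₃ {f v-u} {f v-wr} all-f))
every-arc-sound f all-f w-u  = proj₁ (T-∧₃ {f w-u} {f wr-v} all-f)
every-arc-sound f all-f wr-v = proj₁ (proj₂ (T-∧₃ {f w-u} {f wr-v} all-f))
every-arc-sound f all-f ws-v = proj₂ (proj₂ (T-∧₃ {f w-u} {f wr-v} all-f))

every-path : ∀ L K → (∀ {K'} → ArcPath L K K' → Bool) → Bool
every-path zero    K f = f []
every-path (suc L) K f = every-arc K (λ a → every-path L _ (λ p → f (a ∷ p)))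

every-path-sound : ∀ {L K K'} (f : ∀ {K'} → ArcPath L K K' → Bool) →
                   T (every-path L K f) → (p : ArcPath L K K') → T (f p)
every-path-sound f all-f []      = all-f
every-path-sound f all-f (a ∷ p) =
  every-path-sound (λ p → f (a ∷ p)) (every-arc-sound (λ a → every-path _ _ (λ p → f (a ∷ p))) all-f a) p

-- Symbolic positions in the cover: a vertex of kind K at index i₀ + β r + δ g, written
-- (K , β , δ), for a base index i₀ fixed later.  The notions below depend on the
-- factorisation data N, κ, σ only, and are decidable, so that certificates can be checked
-- by evaluation.
Position : Set
Position = Kind × ℤ × ℤ

module Positions (N : ℕ) (κ σ : ℤ) where

  move : ∀ {K K'} → Arc K K' → ℤ × ℤ → ℤ × ℤ
  move a (β , δ) = β + r-coeff a , δ + g-coeff κ σ a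

  positions-from : ∀ {L K K'} → ArcPath L K K' → ℤ × ℤ → List Position
  positions-from {K = K} []      c = (K , c) ∷ []
  positions-from {K = K} (a ∷ p) c = (K , c) ∷ positions-from p (move a c)

  endpoint-from : ∀ {L K K'} → ArcPath L K K' → ℤ × ℤ → ℤ × ℤ
  endpoint-from []      c = c
  endpoint-from (a ∷ p) c = endpoint-from p (move a c)

  origin : Kind → Position
  origin K = K , 0ℤ , 0ℤ

  positions : ∀ {L K K'} → ArcPath L K K' → List Position
  positions p = positions-from p (0ℤ , 0ℤ)

  final : ∀ {L K K'} → ArcPath L K K' → Position
  final {K' = K'} p = K' , endpoint-from p (0ℤ , 0ℤ)

  antipode : Position
  antipode = u , move u-u (0ℤ , 0ℤ)

  -- positions that denote the same vertex (for every base index, once 2k = N g)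
  Same : Position → Position → Set
  Same (K , β , δ) (K' , β' , δ') = K ≡ K' × β - β' ≡ 0ℤ × + N ∣ δ - δ'

  same? : ∀ x y → Dec (Same x y)
  same? (K , β , δ) (K' , β' , δ') = (K ≟ₖ K') ×-dec ((β - β') ℤP.≟ 0ℤ) ×-dec (+ N ∣? δ - δ')

  -- positions whose r-coefficients are close; for these Same is also necessary (when g ≥ 5)
  Close : Position → Position → Set
  Close (_ , β , _) (_ , β' , _) = ∣ β - β' ∣ ℕ.< 5

  close? : ∀ x y → Dec (Close x y)
  close? (_ , β , _) (_ , β' , _) = ∣ β - β' ∣ ℕ.<? 5

  -- Certificate that u_{i₀} is pinned by its antipode, for one arc path p from u to u: its
  -- end is close to the start (so its lift closes up exactly when end and start are the
  -- same position), and if it closes up then it visits the antipode.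
  PinsAntipode : ∀ {L} → ArcPath L u u → Set
  PinsAntipode p = Close (final p) (origin u) × (Same (final p) (origin u) → Any (Same antipode) (positions p))

  pins-antipode? : ∀ {L} (p : ArcPath L u u) → Dec (PinsAntipode p)
  pins-antipode? p = close? (final p) (origin u) ×-dec
                     (same? (final p) (origin u) →-dec any? (same? antipode) (positions p))

  -- the check over all arc paths out of u; those not ending at u are irrelevant
  pins-antipode-at-u : ∀ {L K} → ArcPath L u K → Bool
  pins-antipode-at-u {K = u} p = isYes (pins-antipode? p)
  pins-antipode-at-u {K = v} p = true
  pins-antipode-at-u {K = w} p = true

  AllPinAntipode : ℕ → Set
  AllPinAntipode L = T (every-path L u pins-antipode-at-u)

  all-pin-antipode : ∀ {L} → AllPinAntipode L → (p : ArcPath L u u) → PinsAntipode p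
  all-pin-antipode all p = toWitness (every-path-sound pins-antipode-at-u all p)

  -- Certificate that the arc path p lifts to a closed walk at v_{i₀} avoiding the vertex at
  -- position y.
  Avoids : ∀ {L} → ArcPath L v v → Position → Set
  Avoids p y = Same (final p) (origin v) × All (λ x → Close y x × ¬ Same y x) (positions p)

  avoids? : ∀ {L} (p : ArcPath L v v) y → Dec (Avoids p y)
  avoids? p y = same? (final p) (origin v) ×-dec all? (λ x → close? y x ×-dec ¬? (same? y x)) (positions p)

  avoided-by : ∀ {L} → (∀ {K} → Arc v K → ArcPath L v v) → ∀ {K} → Arc v K → Bool
  avoided-by avoiding {K} a = isYes (avoids? (avoiding a) (K , move a (0ℤ , 0ℤ)))

  AllAvoided : ∀ {L} → (∀ {K} → Arc v K → ArcPath L v v) → Set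
  AllAvoided avoiding = T (every-arc v (avoided-by avoiding))

  all-avoided : ∀ {L K} (avoiding : ∀ {K} → Arc v K → ArcPath L v v) → AllAvoided avoiding →
                (a : Arc v K) → Avoids (avoiding a) (K , move a (0ℤ , 0ℤ))
  all-avoided avoiding all a = toWitness (every-arc-sound (avoided-by avoiding) all a)

module Cover (k : ℕ) (r s : Fin (2 ℕ.* k)) (g N : ℕ) (κ σ : ℤ)
  (k≡κg : + k ≡ κ * + g) (n≡Ng : 2 ℕ.* k ≡ N ℕ.* g)
  (s≈r+σg : Modular._≈_ (2 ℕ.* k) (toℤ s) (toℤ r + σ * + g)) where

  n : ℕ
  n = 2 ℕ.* k

  open Modular n

  R G : ℤ
  R = toℤ r
  G = + g

  shift : ∀ {K K'} → Arc K K' → ℤ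
  shift a = r-coeff a * R + g-coeff κ σ a * G

  open Positions N κ σ

  arcOf : ∀ {x y} → Adj k r s x y → Arc (proj₁ x) (proj₁ y)
  arcOf (uu _)  = u-u
  arcOf (uu' _) = u-u
  arcOf (uv _)  = u-v
  arcOf (vu _)  = v-u
  arcOf (uw _)  = u-w
  arcOf (wu _)  = w-u
  arcOf (vwr _) = v-wr
  arcOf (wvr _) = wr-v
  arcOf (vws _) = v-ws
  arcOf (wvs _) = ws-v

  forward : ∀ (i : Fin n) m {c} → + m ≈ c → toℤ (i ⊕ m) ≈ toℤ i + c
  forward i m m≈c = ≈-trans (⊕-correct i m) (+-cong (≈-refl {toℤ i}) m≈c)
  backward : ∀ (i : Fin n) m {c} → - + m ≈ c → toℤ i ≈ toℤ (i ⊕ m) + c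
  backward i m {c} -m≈c = begin
    toℤ i                       ≡⟨ sym (undo (toℤ i) (+ m)) ⟩
    toℤ i + + m + - + m         ≈⟨ +-cong (≈-sym (⊕-correct i m)) -m≈c ⟩
    toℤ (i ⊕ m) + c             ∎
    where
    undo : ∀ a b → a + b + - b ≡ a
    undo = solve-∀
  stay : ∀ (i : Fin n) → toℤ i ≈ toℤ i + (0ℤ * R + 0ℤ * G)
  stay i = ≈-reflexive (no-shift (toℤ i) R G)
    where
    no-shift : ∀ a R G → a ≡ a + (0ℤ * R + 0ℤ * G)
    no-shift = solve-∀

  edge-shift : ∀ {x y} (e : Adj k r s x y) → toℤ (proj₂ y) ≈ toℤ (proj₂ x) + shift (arcOf e)
  edge-shift (uu i)  = forward i k k≈shift
    where
    k≈shift : + k ≈ 0ℤ * R + κ * G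
    k≈shift = ≈-reflexive (trans k≡κg (sym (ℤP.+-identityˡ (κ * G))))
  edge-shift (uu' i) = backward i k -k≈shift
    where
    -k≈shift : - + k ≈ 0ℤ * R + κ * G
    -k≈shift = begin
      - + k                   ≡⟨ sym (opposite (+ k)) ⟩
      + k + -1ℤ * (+ k + + k) ≡⟨ cong (λ m → + k + -1ℤ * m) k+k≡n ⟩
      + k + -1ℤ * + n         ≈⟨ +-multiple (+ k) -1ℤ ⟩
      + k                    ≡⟨ trans k≡κg (sym (ℤP.+-identityˡ (κ * G))) ⟩
      0ℤ * R + κ * G         ∎
      where
      opposite : ∀ a → a + -1ℤ * (a + a) ≡ - a
      opposite = solve-∀
      k+k≡n : + k + + k ≡ + n
      k+k≡n = trans (sym (ℤP.pos-+ k k)) (cong (λ m → + (k ℕ.+ m)) (sym (ℕP.+-identityʳ k)))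
  edge-shift (uv i)  = stay i
  edge-shift (vu i)  = stay i
  edge-shift (uw i)  = stay i
  edge-shift (wu i)  = stay i
  edge-shift (vwr i) = forward i (toℕ r) (≈-reflexive (by-r R G))
    where
    by-r : ∀ R G → R ≡ 1ℤ * R + 0ℤ * G
    by-r = solve-∀
  edge-shift (wvr i) = backward i (toℕ r) (≈-reflexive (by-r R G))
    where
    by-r : ∀ R G → - R ≡ -1ℤ * R + 0ℤ * G
    by-r = solve-∀
  edge-shift (vws i) = forward i (toℕ s) (≈-trans s≈r+σg (≈-reflexive (by-s R σ G)))
    where
    by-s : ∀ R σ G → R + σ * G ≡ 1ℤ * R + σ * G
    by-s = solve-∀
  edge-shift (wvs i) = backward i (toℕ s) (≈-trans (neg-cong s≈r+σg) (≈-reflexive (by-s R σ G)))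
    where
    by-s : ∀ R σ G → - (R + σ * G) ≡ -1ℤ * R + - σ * G
    by-s = solve-∀


  -- an edge w_{j+t} → v_j out of w_i, taking j = i - t
  back-edge : ∀ {a : Arc w v} (t : Fin n) (edge : ∀ j → Adj k r s (w , j ⊕ toℕ t) (v , j)) →
              (∀ j → toℤ j ≈ toℤ (j ⊕ toℕ t) + shift a) →
              ∀ i → Σ[ j ∈ Fin n ] Adj k r s (w , i) (v , j) × toℤ j ≈ toℤ i + shift a
  back-edge {a} t edge edge-shift′ i =
    j , subst (λ z → Adj k r s (w , z) (v , j)) j+t≡i (edge j) ,
        subst (λ z → toℤ j ≈ toℤ z + shift a) j+t≡i (edge-shift′ j)
    where
    j = i ⊕ (n ℕ.∸ toℕ t)
    j+t≡i : j ⊕ toℕ t ≡ i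
    j+t≡i = ⊕-cancel i (toℕ t) (ℕP.<⇒≤ (FinP.toℕ<n t))

  arc-edge : ∀ {K K'} (a : Arc K K') (i : Fin n) →
             Σ[ j ∈ Fin n ] Adj k r s (K , i) (K' , j) × toℤ j ≈ toℤ i + shift a
  arc-edge u-u  i = i ⊕ k , uu i , edge-shift (uu i)
  arc-edge u-v  i = i , uv i , edge-shift (uv i)
  arc-edge u-w  i = i , uw i , edge-shift (uw i)
  arc-edge v-u  i = i , vu i , edge-shift (vu i)
  arc-edge w-u  i = i , wu i , edge-shift (wu i)
  arc-edge v-wr i = i ⊕ toℕ r , vwr i , edge-shift (vwr i)
  arc-edge v-ws i = i ⊕ toℕ s , vws i , edge-shift (vws i)
  arc-edge wr-v i = back-edge {wr-v} r wvr (λ j → edge-shift (wvr j)) i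
  arc-edge ws-v i = back-edge {ws-v} s wvs (λ j → edge-shift (wvs j)) i

  path-shift : ∀ {x y} → Star (Adj k r s) x y →
               Σ[ β ∈ ℤ ] Σ[ δ ∈ ℤ ] toℤ (proj₂ y) ≈ toℤ (proj₂ x) + (β * R + δ * G)
  path-shift {x} ε = 0ℤ , 0ℤ , stay (proj₂ x)
  path-shift {x} {z} (_◅_ {j = y} e p) with path-shift p
  ... | β , δ , y→z = r-coeff (arcOf e) + β , g-coeff κ σ (arcOf e) + δ , (begin
    toℤ (proj₂ z)                                  ≈⟨ y→z ⟩
    toℤ (proj₂ y) + (β * R + δ * G)                ≈⟨ +-cong (edge-shift e) (≈-refl {β * R + δ * G}) ⟩
    toℤ (proj₂ x) + shift (arcOf e) + (β * R + δ * G)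
      ≡⟨ collect (toℤ (proj₂ x)) (r-coeff (arcOf e)) (g-coeff κ σ (arcOf e)) β δ R G ⟩
    toℤ (proj₂ x) + ((r-coeff (arcOf e) + β) * R + (g-coeff κ σ (arcOf e) + δ) * G) ∎)
    where
    collect : ∀ a ρ γ β δ R G → a + (ρ * R + γ * G) + (β * R + δ * G) ≡ a + ((ρ + β) * R + (γ + δ) * G)
    collect = solve-∀

  g∣n : + g ∣ + n
  g∣n = divides (+ N) (trans (cong +_ n≡Ng) (ℤP.pos-* N g))

  -- if T₁ is connected then g and r are coprime: the path from u_i to u_{i+1} shows that
  -- 1 is congruent modulo n (a multiple of g) to a combination of r and g
  connected⇒coprime : Connected k r s → Fin n → Coprime g (toℕ r)
  connected⇒coprime connected i {q} (q∣g , q∣r) with path-shift (connected (u , i) (u , i ⊕ 1))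
  ... | β , δ , i+1≈i+shift = ℕD.∣1⇒≡1 (∣⇒∣ᵤ q∣1)
    where
    q∣n : + q ∣ + n
    q∣n = ∣-trans (∣ᵤ⇒∣ q∣g) g∣n
    1≈shift : 1ℤ ≈ β * R + δ * G
    1≈shift = +-cancelˡ (toℤ i) (≈-trans (≈-sym (⊕-correct i 1)) i+1≈i+shift)
    q∣shift : + q ∣ β * R + δ * G
    q∣shift = ∣m∣n⇒∣m+n (∣n⇒∣m*n β (∣ᵤ⇒∣ q∣r)) (∣n⇒∣m*n δ (∣ᵤ⇒∣ q∣g))
    q∣1 : + q ∣ 1ℤ
    q∣1 = subst (+ q ∣_) (restore 1ℤ (β * R + δ * G))
            (∣m∣n⇒∣m+n (∣-trans q∣n (divides-difference 1≈shift)) q∣shift)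
      where
      restore : ∀ a b → a - b + b ≡ a
      restore = solve-∀

  vanishing-shift : Coprime g (toℕ r) → ∀ β δ → ∣ β ∣ ℕ.< g → β * R + δ * G ≈ 0ℤ → β ≡ 0ℤ × + N ∣ δ
  vanishing-shift coprime β δ ∣β∣<g shift≈0 = β≡0 , N∣δ
    where
    n∣shift : + n ∣ β * R + δ * G
    n∣shift = ≈0⇒∣ shift≈0
    g∣βR : + g ∣ β * R
    g∣βR = ∣m+n∣n⇒∣m (∣-trans g∣n n∣shift) (∣n⇒∣m*n δ ∣-refl)
    g∣∣β∣ : g ℕD.∣ ∣ β ∣
    g∣∣β∣ = coprime-divisor coprime
      (subst (g ℕD.∣_) (trans (cong ∣_∣ (ℤP.*-comm β R)) (ℤP.abs-* R β)) (∣⇒∣ᵤ g∣βR))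
    β≡0 : β ≡ 0ℤ
    β≡0 = ℤP.∣i∣≡0⇒i≡0 (divisible-below⇒0 g∣∣β∣ ∣β∣<g)
    n∣δG : + N * G ∣ δ * G
    n∣δG = subst₂ _∣_ (trans (cong +_ n≡Ng) (ℤP.pos-* N g)) (without-r R (δ * G))
             (subst (λ b → + n ∣ b * R + δ * G) β≡0 n∣shift)
      where
      without-r : ∀ R a → 0ℤ * R + a ≡ a
      without-r = solve-∀
    N∣δ : + N ∣ δ
    N∣δ = *-cancelʳ-∣ G {{ℕ.>-nonZero (ℕP.≤-<-trans ℕ.z≤n ∣β∣<g)}} n∣δG

  multiple-shift : ∀ {δ} → + N ∣ δ → δ * G ≈ 0ℤ
  multiple-shift {δ} (divides q δ≡qN) = ∣⇒≈0 (divides q (trans (cong (_* G) δ≡qN)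
    (trans (ℤP.*-assoc q (+ N) G) (cong (q *_) (trans (sym (ℤP.pos-* N g)) (cong +_ (sym n≡Ng)))))))

  module Lifting (coprime : Coprime g (toℕ r)) (5≤g : 5 ℕ.≤ g) (i₀ : Fin n) where

    open Walks (Adj k r s)

    infix 4 _At_ _LiesOver_
    record _At_ (i : Fin n) (c : ℤ × ℤ) : Set where
      constructor at
      field index-at : toℤ i ≈ toℤ i₀ + (proj₁ c * R + proj₂ c * G)

    _LiesOver_ : Vtx k → Position → Set
    (K , i) LiesOver (K' , c) = K ≡ K' × i At c

    base-at-origin : i₀ At (0ℤ , 0ℤ)
    base-at-origin = at (≈-reflexive (no-shift (toℤ i₀) R G))
      where
      no-shift : ∀ a R G → a ≡ a + (0ℤ * R + 0ℤ * G)
      no-shift = solve-∀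

    step-at : ∀ {i j c K K'} {a : Arc K K'} → i At c → toℤ j ≈ toℤ i + shift a → j At move a c
    step-at {i} {j} {β , δ} {a = a} (at i-at) j≈i+a = at (begin
      toℤ j                                        ≈⟨ j≈i+a ⟩
      toℤ i + shift a                              ≈⟨ +-cong i-at (≈-refl {shift a}) ⟩
      toℤ i₀ + (β * R + δ * G) + shift a
        ≡⟨ collect (toℤ i₀) β δ (r-coeff a) (g-coeff κ σ a) R G ⟩
      toℤ i₀ + ((β + r-coeff a) * R + (δ + g-coeff κ σ a) * G) ∎)
      where
      collect : ∀ a β δ ρ γ R G → a + (β * R + δ * G) + (ρ * R + γ * G) ≡ a + ((β + ρ) * R + (δ + γ) * G)
      collect = solve-∀

    at-difference : ∀ {i j β δ β' δ'} → i At (β , δ) → j At (β' , δ') →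
                    toℤ i ≈ toℤ j + ((β - β') * R + (δ - δ') * G)
    at-difference {i} {j} {β} {δ} {β'} {δ'} (at i-at) (at j-at) = begin
      toℤ i                                                    ≈⟨ i-at ⟩
      toℤ i₀ + (β * R + δ * G)                                 ≡⟨ split (toℤ i₀) β δ β' δ' R G ⟩
      toℤ i₀ + (β' * R + δ' * G) + ((β - β') * R + (δ - δ') * G)
        ≈⟨ +-cong (≈-sym j-at) (≈-refl {(β - β') * R + (δ - δ') * G}) ⟩
      toℤ j + ((β - β') * R + (δ - δ') * G)                    ∎
      where
      split : ∀ a β δ β' δ' R G →
              a + (β * R + δ * G) ≡ a + (β' * R + δ' * G) + ((β - β') * R + (δ - δ') * G)
      split = solve-∀

    same⇒equal : ∀ {x y p q} → x LiesOver p → y LiesOver q → Same p q → x ≡ y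
    same⇒equal {K , i} {K' , j} {_ , β , δ} {_ , β' , δ'}
               (refl , i-at) (refl , j-at) (K≡K' , β-β'≡0 , N∣δ-δ') =
      cong₂ _,_ K≡K' (≈⇒≡ i j (begin
        toℤ i                                    ≈⟨ at-difference i-at j-at ⟩
        toℤ j + ((β - β') * R + (δ - δ') * G)    ≡⟨ cong (λ b → toℤ j + (b * R + (δ - δ') * G)) β-β'≡0 ⟩
        toℤ j + (0ℤ * R + (δ - δ') * G)          ≡⟨ cong (_+_ (toℤ j)) (ℤP.+-identityˡ ((δ - δ') * G)) ⟩
        toℤ j + (δ - δ') * G                     ≈⟨ +-cong (≈-refl {toℤ j}) (multiple-shift N∣δ-δ') ⟩
        toℤ j + 0ℤ                               ≡⟨ ℤP.+-identityʳ (toℤ j) ⟩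
        toℤ j                                    ∎))

    equal⇒same : ∀ {x p q} → x LiesOver p → x LiesOver q → Close p q → Same p q
    equal⇒same {K , i} {_ , β , δ} {_ , β' , δ'} (refl , i-at) (refl , i-at') close =
      refl , vanishing-shift coprime (β - β') (δ - δ') (ℕP.<-≤-trans close 5≤g) difference≈0
      where
      difference≈0 : (β - β') * R + (δ - δ') * G ≈ 0ℤ
      difference≈0 = +-cancelˡ (toℤ i) (≈-trans (≈-sym (at-difference i-at i-at'))
                                                 (≈-reflexive (sym (ℤP.+-identityʳ (toℤ i)))))

    arcs : ∀ {L x y} → Walk L x y → ArcPath L (proj₁ x) (proj₁ y)
    arcs []      = []
    arcs (e ∷ W) = arcOf e ∷ arcs W

    project : ∀ {L x y c} → proj₂ x At c → (W : Walk L x y) →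
              Pointwise _LiesOver_ (vertices W) (positions-from (arcs W) c) × proj₂ y At endpoint-from (arcs W) c
    project x-at []      = (refl , x-at) ∷ [] , x-at
    project x-at (e ∷ W) with project (step-at x-at (edge-shift e)) W
    ... | follows , y-at = (refl , x-at) ∷ follows , y-at

    lift : ∀ {L K K' i c} → i At c → (p : ArcPath L K K') →
           Σ[ j ∈ Fin n ] Σ[ W ∈ Walk L (K , i) (K' , j) ]
             Pointwise _LiesOver_ (vertices W) (positions-from p c) × j At endpoint-from p c
    lift {i = i} i-at []      = i , [] , (refl , i-at) ∷ [] , i-at
    lift {i = i} i-at (a ∷ p) with arc-edge a i
    ... | i' , e , i'≈i+a with lift (step-at {a = a} i-at i'≈i+a) p
    ...   | j , W , follows , j-at = j , e ∷ W , (refl , i-at) ∷ follows , j-at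

    -- u_{i₀} is pinned by its antipode u_{i₀+k}: a closed walk at u_{i₀} lies over a closed
    -- arc path, which by the certificate visits the antipode position
    pinned-u : ∀ {L} → AllPinAntipode L → Pinned L (u , i₀)
    pinned-u {L} certificate = (u , i₀ ⊕ k) , uu i₀ , visits-antipode
      where
      antipode-over : (u , i₀ ⊕ k) LiesOver antipode
      antipode-over = refl , step-at {a = u-u} base-at-origin (edge-shift (uu i₀))

      visits-antipode : (W : Walk L (u , i₀) (u , i₀)) → (u , i₀ ⊕ k) ∈ vertices W
      visits-antipode W with project base-at-origin W | all-pin-antipode certificate (arcs W)
      ... | follows , end-at | close , closes⇒visits =
        any-along follows (λ x-over same → same⇒equal antipode-over x-over same)
          (closes⇒visits (equal⇒same (refl , end-at) (refl , base-at-origin) close))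

    -- v_{i₀} is not pinned: for its neighbour y, the certificate path lifts to a closed walk
    -- at v_{i₀} none of whose vertices is y
    unpinned-v : ∀ {L} (avoiding : ∀ {K} → Arc v K → ArcPath L v v) →
                 AllAvoided avoiding → ¬ Pinned L (v , i₀)
    unpinned-v avoiding certificate ((K , j) , e , pins)
      with all-avoided avoiding certificate (arcOf e) | lift base-at-origin (avoiding (arcOf e))
    ... | closes , apart | j' , W , follows , end-at = none-along follows excluded apart y∈W
      where
      y-over : (K , j) LiesOver (K , move (arcOf e) (0ℤ , 0ℤ))
      y-over = refl , step-at {a = arcOf e} base-at-origin (edge-shift e)

      returns : (v , j') ≡ (v , i₀)
      returns = same⇒equal (refl , end-at) (refl , base-at-origin) closes

      y∈W : (K , j) ∈ vertices W
      y∈W = subst ((K , j) ∈_) (vertices-retarget refl returns W) (pins (retarget refl returns W))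

      excluded : ∀ {x q} → x LiesOver q → Close (K , move (arcOf e) (0ℤ , 0ℤ)) q ×
                 ¬ Same (K , move (arcOf e) (0ℤ , 0ℤ)) q → ¬ (K , j) ≡ x
      excluded x-over (close , different) refl = different (equal⇒same y-over x-over close)

    -- vertex-transitivity would carry the pinned u_{i₀} to the unpinned v_{i₀}
    not-vertex-transitive : ∀ {L} (avoiding : ∀ {K} → Arc v K → ArcPath L v v) →
                            AllPinAntipode L → AllAvoided avoiding → ¬ VertexTransitive k r s
    not-vertex-transitive {L} avoiding pins avoided transitive with transitive (u , i₀) (v , i₀)
    ... | τ , τu≡v = unpinned-v avoiding avoided
          (subst (Pinned L) τu≡v (pinned-invariant perm (preserves _ _) from-hom (pinned-u pins)))
      where
      open Automorphism τ
      from-hom : ∀ {x y} → Adj k r s x y → Adj k r s (from x) (from y)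
      from-hom e = reflects _ _ (subst₂ (Adj k r s) (sym (strictlyInverseˡ _)) (sym (strictlyInverseˡ _)) e)

  certified⇒not-vertex-transitive : Connected k r s → 5 ℕ.≤ g → Fin n →
    ∀ {L} (avoiding : ∀ {K} → Arc v K → ArcPath L v v) →
    AllPinAntipode L → AllAvoided avoiding → ¬ VertexTransitive k r s
  certified⇒not-vertex-transitive connected 5≤g i₀ =
    Lifting.not-vertex-transitive (connected⇒coprime connected i₀) 5≤g i₀

-- The solutions 0 < d < 2k of 4d ≡ 0 (mod 2k): a half turn d = k, or k = 2g and d is a
-- quarter turn g or a three-quarter turn 3g.
data QuarterTurn (k d : ℕ) : Set where
  half-turn          : d ≡ k → QuarterTurn k d
  quarter-turn       : ∀ g → k ≡ 2 ℕ.* g → d ≡ g → QuarterTurn k d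
  three-quarter-turn : ∀ g → k ≡ 2 ℕ.* g → d ≡ 3 ℕ.* g → QuarterTurn k d

-- 4d = t · 2k means 2d = t k, and 0 < 2d < 4k leaves t ∈ {1, 2, 3}
quarter-turns : ∀ {k d} → 0 ℕ.< d → d ℕ.< 2 ℕ.* k → (2 ℕ.* k) ℕD.∣ (4 ℕ.* d) → QuarterTurn k d
quarter-turns {k} {d} 0<d d<2k (ℕD.divides t 4d≡t·2k) = by-multiple t 2d≡tk
  where
  open ≡-Reasoning
  2d≡tk : 2 ℕ.* d ≡ t ℕ.* k
  2d≡tk = ℕP.*-cancelˡ-≡ (2 ℕ.* d) (t ℕ.* k) 2 (begin
    2 ℕ.* (2 ℕ.* d)   ≡⟨ double d ⟩
    4 ℕ.* d           ≡⟨ 4d≡t·2k ⟩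
    t ℕ.* (2 ℕ.* k)   ≡⟨ swap t k ⟩
    2 ℕ.* (t ℕ.* k)   ∎)
    where
    double : ∀ d → 2 ℕ.* (2 ℕ.* d) ≡ 4 ℕ.* d
    double = ℕSolver.solve-∀
    swap : ∀ t k → t ℕ.* (2 ℕ.* k) ≡ 2 ℕ.* (t ℕ.* k)
    swap = ℕSolver.solve-∀

  by-multiple : ∀ t → 2 ℕ.* d ≡ t ℕ.* k → QuarterTurn k d
  by-multiple 0 2d≡0 = ⊥-elim (ℕP.<⇒≢ 0<d (sym (ℕP.*-cancelˡ-≡ d 0 2 2d≡0)))
  by-multiple 1 2d≡k = quarter-turn d (sym (trans 2d≡k (ℕP.*-identityˡ k))) refl
  by-multiple 2 2d≡2k = half-turn (ℕP.*-cancelˡ-≡ d k 2 2d≡2k)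
  by-multiple 3 2d≡3k = three-quarter-turn (d ℕ.∸ k) k≡2g d≡3g
    where
    k≤d : k ℕ.≤ d
    k≤d = ℕP.*-cancelˡ-≤ 2 (subst (2 ℕ.* k ℕ.≤_) (sym 2d≡3k) (ℕP.*-monoˡ-≤ k (ℕP.n≤1+n 2)))
    d≡k+g : d ≡ k ℕ.+ (d ℕ.∸ k)
    d≡k+g = sym (ℕP.m+[n∸m]≡n k≤d)
    k≡2g : k ≡ 2 ℕ.* (d ℕ.∸ k)
    k≡2g = sym (ℕP.+-cancelˡ-≡ (2 ℕ.* k) (2 ℕ.* (d ℕ.∸ k)) k (begin
      2 ℕ.* k ℕ.+ 2 ℕ.* (d ℕ.∸ k)    ≡⟨ sym (ℕP.*-distribˡ-+ 2 k (d ℕ.∸ k)) ⟩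
      2 ℕ.* (k ℕ.+ (d ℕ.∸ k))        ≡⟨ cong (2 ℕ.*_) (sym d≡k+g) ⟩
      2 ℕ.* d                        ≡⟨ 2d≡3k ⟩
      3 ℕ.* k                        ≡⟨ triple k ⟩
      2 ℕ.* k ℕ.+ k                  ∎))
      where
      triple : ∀ k → 3 ℕ.* k ≡ 2 ℕ.* k ℕ.+ k
      triple = ℕSolver.solve-∀
    d≡3g : d ≡ 3 ℕ.* (d ℕ.∸ k)
    d≡3g = begin
      d                              ≡⟨ d≡k+g ⟩
      k ℕ.+ (d ℕ.∸ k)                ≡⟨ cong (ℕ._+ (d ℕ.∸ k)) k≡2g ⟩
      2 ℕ.* (d ℕ.∸ k) ℕ.+ (d ℕ.∸ k)  ≡⟨ triple (d ℕ.∸ k) ⟩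
      3 ℕ.* (d ℕ.∸ k)                ∎
      where
      triple : ∀ g → 2 ℕ.* g ℕ.+ g ≡ 3 ℕ.* g
      triple = ℕSolver.solve-∀
  by-multiple (suc (suc (suc (suc t)))) 2d≡[4+t]k = ⊥-elim (ℕP.<⇒≱ 2d<4k 4k≤2d)
    where
    2d<4k : 2 ℕ.* d ℕ.< 4 ℕ.* k
    2d<4k = subst (2 ℕ.* d ℕ.<_) (double k) (ℕP.*-monoʳ-< 2 d<2k)
      where
      double : ∀ k → 2 ℕ.* (2 ℕ.* k) ≡ 4 ℕ.* k
      double = ℕSolver.solve-∀
    4k≤2d : 4 ℕ.* k ℕ.≤ 2 ℕ.* d
    4k≤2d = subst (4 ℕ.* k ℕ.≤_) (sym 2d≡[4+t]k) (ℕP.*-monoˡ-≤ k (ℕP.m≤m+n 4 t))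

four-turns-vanish : ∀ {k} (r s : Fin (2 ℕ.* k)) d → Modular._≈_ (2 ℕ.* k) (toℤ s) (toℤ r + + d) →
                    FourRSCond k r s → (2 ℕ.* k) ℕD.∣ (4 ℕ.* d)
four-turns-vanish {k} r s d s≈r+d four =
  subst ((2 ℕ.* k) ℕD.∣_) (cong ∣_∣ (sym (ℤP.pos-* 4 d)))
    (∣⇒∣ᵤ (≈0⇒∣ (+-cancelˡ (+ 4 * toℤ r) 4r+4d≈4r+0)))
  where
  open Modular (2 ℕ.* k)
  4r+4d≈4r+0 : + 4 * toℤ r + + 4 * + d ≈ + 4 * toℤ r + 0ℤ
  4r+4d≈4r+0 = begin
    + 4 * toℤ r + + 4 * + d       ≡⟨ sym (ℤP.*-distribˡ-+ (+ 4) (toℤ r) (+ d)) ⟩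
    + 4 * (toℤ r + + d)           ≈⟨ *-congˡ (+ 4) (≈-sym s≈r+d) ⟩
    + 4 * toℤ s                   ≡⟨ sym (ℤP.pos-* 4 (toℕ s)) ⟩
    + (4 ℕ.* toℕ s)               ≈⟨ ≈-sym (mod (∣ᵤ⇒∣ four)) ⟩
    + (4 ℕ.* toℕ r)               ≡⟨ ℤP.pos-* 4 (toℕ r) ⟩
    + 4 * toℤ r                   ≡⟨ sym (ℤP.+-identityʳ (+ 4 * toℤ r)) ⟩
    + 4 * toℤ r + 0ℤ              ∎

half-of-≥9 : ∀ g → 9 ℕ.≤ 2 ℕ.* g → 5 ℕ.≤ g
half-of-≥9 g 9≤2g with 5 ℕ.≤? g
... | yes 5≤g = 5≤g
... | no 5≰g = ⊥-elim (ℕP.≤⇒≯ (ℕP.*-monoʳ-≤ 2 (ℕP.≤-pred (ℕP.≰⇒> 5≰g))) 9≤2g)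

-- Closed arc paths at v avoiding the neighbour over the given arc, of lengths 5 and 7.
avoiding₅ : ∀ {K} → Arc v K → ArcPath 5 v v
avoiding₅ v-u  = v-wr ∷ w-u ∷ u-u ∷ u-w ∷ ws-v ∷ []
avoiding₅ v-wr = v-u ∷ u-u ∷ u-v ∷ v-wr ∷ ws-v ∷ []
avoiding₅ v-ws = v-u ∷ u-u ∷ u-v ∷ v-ws ∷ wr-v ∷ []

avoiding₇ : ∀ {K} → Arc v K → ArcPath 7 v v
avoiding₇ v-u  = v-wr ∷ w-u ∷ u-u ∷ u-w ∷ ws-v ∷ v-wr ∷ ws-v ∷ []
avoiding₇ v-wr = v-u ∷ u-u ∷ u-v ∷ v-wr ∷ ws-v ∷ v-wr ∷ ws-v ∷ []
avoiding₇ v-ws = v-u ∷ u-u ∷ u-v ∷ v-ws ∷ wr-v ∷ v-ws ∷ wr-v ∷ []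

-- The certificates, checked by evaluation.  Half turn s - r ≡ k: take g = k, N = 2,
-- κ = σ = 1 and closed walks of length 5.
module HalfTurn = Positions 2 1ℤ 1ℤ

half-turn-pins : HalfTurn.AllPinAntipode 5
half-turn-pins = tt

half-turn-avoids : HalfTurn.AllAvoided avoiding₅
half-turn-avoids = tt

-- Quarter turns s - r ≡ g and s - r ≡ 3g with k = 2g: take N = 4, κ = 2, σ = 1 or 3, and
-- closed walks of length 7.
module QuarterTurn₁ = Positions 4 (+ 2) 1ℤ
module QuarterTurn₃ = Positions 4 (+ 2) (+ 3)

quarter-turn-pins : QuarterTurn₁.AllPinAntipode 7
quarter-turn-pins = tt

quarter-turn-avoids : QuarterTurn₁.AllAvoided avoiding₇
quarter-turn-avoids = tt

three-quarter-turn-pins : QuarterTurn₃.AllPinAntipode 7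
three-quarter-turn-pins = tt

three-quarter-turn-avoids : QuarterTurn₃.AllAvoided avoiding₇
three-quarter-turn-avoids = tt

quarter-factorisation : ∀ {k g} → k ≡ 2 ℕ.* g → + k ≡ + 2 * + g × 2 ℕ.* k ≡ 4 ℕ.* g
quarter-factorisation {g = g} refl = ℤP.pos-* 2 g , double g
  where
  double : ∀ g → 2 ℕ.* (2 ℕ.* g) ≡ 4 ℕ.* g
  double = ℕSolver.solve-∀

-- The three shapes of the difference d = s - r, each settled by the cover criterion with
-- the matching factorisation and certificates (the base index can be any, say r).
module _ {k : ℕ} (r s : Fin (2 ℕ.* k)) (9≤k : 9 ℕ.≤ k) (connected : Connected k r s) where
  open Modular (2 ℕ.* k)

  private
    refine : ∀ {d} σ g → toℤ s ≈ toℤ r + + d → + d ≡ σ * + g → toℤ s ≈ toℤ r + σ * + g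
    refine σ g s≈r+d d≡σg = subst (λ x → toℤ s ≈ toℤ r + x) d≡σg s≈r+d

  by-turn : ∀ {d} → toℤ s ≈ toℤ r + + d → QuarterTurn k d → ¬ VertexTransitive k r s
  by-turn s≈r+d (half-turn d≡k) =
    Cover.certified⇒not-vertex-transitive k r s k 2 1ℤ 1ℤ (sym (ℤP.*-identityˡ (+ k))) refl
      (refine 1ℤ k s≈r+d (trans (cong +_ d≡k) (sym (ℤP.*-identityˡ (+ k)))))
      connected (ℕP.≤-trans (ℕP.m≤m+n 5 4) 9≤k) r avoiding₅ half-turn-pins half-turn-avoids
  by-turn s≈r+d (quarter-turn g k≡2g d≡g) with quarter-factorisation {k} {g} k≡2g
  ... | k≡2·g , 2k≡4g =
    Cover.certified⇒not-vertex-transitive k r s g 4 (+ 2) 1ℤ k≡2·g 2k≡4g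
      (refine 1ℤ g s≈r+d (trans (cong +_ d≡g) (sym (ℤP.*-identityˡ (+ g)))))
      connected (half-of-≥9 g (subst (9 ℕ.≤_) k≡2g 9≤k)) r avoiding₇ quarter-turn-pins quarter-turn-avoids
  by-turn s≈r+d (three-quarter-turn g k≡2g d≡3g) with quarter-factorisation {k} {g} k≡2g
  ... | k≡2·g , 2k≡4g =
    Cover.certified⇒not-vertex-transitive k r s g 4 (+ 2) (+ 3) k≡2·g 2k≡4g
      (refine (+ 3) g s≈r+d (trans (cong +_ d≡3g) (ℤP.pos-* 3 g)))
      connected (half-of-≥9 g (subst (9 ℕ.≤_) k≡2g 9≤k)) r avoiding₇
      three-quarter-turn-pins three-quarter-turn-avoids

lemma4p11 : (k : ℕ) → 9 ℕ.≤ k → (r s : Fin (2 ℕ.* k)) → r ≢ s →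
    Connected k r s → FourRSCond k r s → ¬ VertexTransitive k r s
lemma4p11 k 9≤k r s r≢s connected four =
  by-turn r s 9≤k connected s≈r+d
    (quarter-turns {k} (difference-nonzero r s r≢s) (FinP.toℕ<n _) (four-turns-vanish {k} r s d s≈r+d four))
  where
  d : ℕ
  d = toℕ (s ⊕ (2 ℕ.* k ℕ.∸ toℕ r))
  s≈r+d : Modular._≈_ (2 ℕ.* k) (toℤ s) (toℤ r + + d)
  s≈r+d = difference-correct r s
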